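{- Let $G$ be a bipartite graph with bipartition $(X,Y)$, let $k\ge 1$ be an integer, let $W=X$, and define $f,g:V(G)\to\mathbb{Z}$ by $f(v)=2$, $g(v)=0$ for $v\in X$ and $f(v)=g(v)=k$ for $v\in Y$. If $k|Y|$ is even, then $\delta_G(A,B)\equiv 0\pmod 2$ for all disjoint subsets $A,B\subseteq V(G)$.
   Context: For a graph $G$, $W\subseteq V(G)$, functions $f,g:V(G)\to\mathbb{Z}$, and disjoint $A,B\subseteq V(G)$, define $\delta_G(A,B)=\sum_{v\in A}f(v)-\sum_{v\in B}g(v)+\sum_{v\in B}d_{G-A}(v)-h_W(A,B)$, where $d_{G-A}(v)$ is the degree of $v$ in $G-A$, and $h_W(A,B)$ is the number of connected components $D$ of $G-(A\cup B)$ such that $g(v)=f(v)$ for all $v\in V(D)\setminus W$ and $\sum_{v\in V(D)}f(v)+e_G(D,B)\equiv 1\pmod 2$; here $e_G(D,B)$ is the number of edges of $G$ with one end in $V(D)$ and the other in $B$. -}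

module Defs where

open import Data.Bool using (Bool; true; false; _∧_; _∨_; not; if_then_else_)
open import Data.Nat as ℕ using (ℕ; zero; suc)
open import Data.Fin using (Fin; zero; suc; _<?_; _≟_)
open import Data.Integer as ℤ using (ℤ; +_; _+_; _-_; ∣_∣)
open import Relation.Binary.PropositionalEquality using (_≡_)
open import Relation.Nullary.Decidable using (⌊_⌋)

record Graph (n : ℕ) : Set where
  field
    adj     : Fin n → Fin n → Bool
    sym     : ∀ u v → adj u v ≡ adj v u
    irrefl  : ∀ v → adj v v ≡ false
open Graph public

VSet : ℕ → Set
VSet n = Fin n → Bool

Σℤ : ∀ {n} → (Fin n → ℤ) → ℤ
Σℤ {zero}  f = + 0
Σℤ {suc n} f = f zero + Σℤ (λ i → f (suc i))

count : ∀ {n} → (Fin n → Bool) → ℕ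
count {zero}  p = 0
count {suc n} p = (if p zero then 1 else 0) ℕ.+ count (λ i → p (suc i))

any : ∀ {n} → (Fin n → Bool) → Bool
any {zero}  p = false
any {suc n} p = p zero ∨ any (λ i → p (suc i))

all : ∀ {n} → (Fin n → Bool) → Bool
all p = not (any (λ i → not (p i)))

Disjoint : ∀ {n} → VSet n → VSet n → Set
Disjoint A B = ∀ v → A v ∧ B v ≡ false

-- Bipartite with bipartition (X, Y): X is given by its characteristic
-- function, Y is its complement, and every edge joins X and Y.
IsBipartition : ∀ {n} → Graph n → VSet n → Set
IsBipartition G X = ∀ u v → adj G u v ≡ true → X u ≡ not (X v)

degMinus : ∀ {n} → Graph n → VSet n → Fin n → ℕ
degMinus G A v = count (λ u → adj G v u ∧ not (A u))

reach : ∀ {n} → Graph n → VSet n → ℕ → Fin n → Fin n → Bool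
reach G R zero    u v = R u ∧ R v ∧ ⌊ u ≟ v ⌋
reach G R (suc k) u v =
  reach G R k u v ∨ any (λ w → reach G R k u w ∧ adj G w v ∧ R v)

-- u and v lie in the same connected component of G[R].
-- (A walk can be shortened to a path, which has length < n.)
sameComp : ∀ {n} → Graph n → VSet n → Fin n → Fin n → Bool
sameComp {n} G R u v = reach G R n u v

Σℕ : ∀ {n} → (Fin n → ℕ) → ℕ
Σℕ {zero}  f = 0
Σℕ {suc n} f = f zero ℕ.+ Σℕ (λ i → f (suc i))

-- e_G(D, B) where D is the component of G[R] containing r:
-- number of edges with one end in D and the other in B.
eComp : ∀ {n} → Graph n → VSet n → Fin n → VSet n → ℕ
eComp G R r B =
  Σℕ (λ u → if sameComp G R r u then count (λ w → adj G u w ∧ B w) else 0)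

isOdd : ℤ → Bool
isOdd x = ⌊ ∣ x ∣ ℕ.% 2 ℕ.≟ 1 ⌋

module _ {n : ℕ} (G : Graph n) (W : VSet n) (f g : Fin n → ℤ) where

  -- h_W(A,B): number of components D of G-(A∪B) with g = f on V(D)∖W
  -- and Σ_{v∈D} f(v) + e_G(D,B) odd.  Each component is counted once,
  -- via its least vertex (in the order of Fin n).
  hW : VSet n → VSet n → ℕ
  hW A B = count isCountedRep
    where
      R : VSet n
      R v = not (A v ∨ B v)
      isRep : Fin n → Bool
      isRep r = R r ∧ not (any (λ u → ⌊ u <? r ⌋ ∧ sameComp G R u r))
      gfOK : Fin n → Bool
      gfOK r = all (λ v → not (sameComp G R r v ∧ not (W v))
                          ∨ ⌊ g v ℤ.≟ f v ⌋)
      odd : Fin n → Bool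
      odd r = isOdd (Σℤ (λ v → if sameComp G R r v then f v else + 0)
                     + + eComp G R r B)
      isCountedRep : Fin n → Bool
      isCountedRep r = isRep r ∧ gfOK r ∧ odd r

  δ : VSet n → VSet n → ℤ
  δ A B = Σℤ (λ v → if A v then f v else + 0)
        - Σℤ (λ v → if B v then g v else + 0)
        + + Σℕ (λ v → if B v then degMinus G A v else 0)
        - + hW A B

{-# OPTIONS --safe #-}
module Submission where

-- Modulo 2 the weights f and g agree (both are k on Y and even on X), and as W = X the
-- condition "g = f on V(D) ∖ W" holds for every component D of G − (A ∪ B). As these
-- components partition V ∖ (A∪B), counting the odd ones modulo 2 gives
--   h_W(A,B) ≡ Σ_{v ∉ A∪B} f(v) + e_G(V ∖ (A∪B), B),
-- while Σ_{v∈B} d_{G−A}(v) ≡ e_G(B, V ∖ (A∪B)) because every edge inside B is counted twice.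
-- Hence δ_G(A,B) ≡ Σ_{v∈V} f(v) ≡ k|Y| ≡ 0 (mod 2).

import Defs
open import Data.Nat.Base using (ℕ)

module Mod2 where

  open import Data.Bool.Base using (Bool; true; false; not; _∧_; _∨_; if_then_else_; T)
  open import Data.Nat.Base as ℕ using (ℕ; zero; suc; parity)
  open import Data.Nat.Divisibility using (divides) renaming (_∣_ to _∣ℕ_)
  import Data.Integer.Base as ℤ
  import Data.Integer.Properties as ℤ
  open import Data.Integer.Divisibility using (_∣_)
  import Data.Integer.Divisibility.Signed as Signed
  open import Data.Integer.Tactic.RingSolver using (solve-∀)
  open import Data.Parity.Base using (Parity; 0ℙ; 1ℙ; _+_; _*_)
  open import Data.Parity.Properties using (+-*-semiring; +-assoc; p+p≡0ℙ; *-zeroʳ; +-homo-+; *-homo-*)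
  open import Data.Fin.Base using (Fin; zero; suc; punchIn)
  open import Data.Fin.Properties using (punchInᵢ≢i)
  open import Relation.Binary.PropositionalEquality
    using (_≡_; refl; sym; trans; cong; cong₂; subst; module ≡-Reasoning)
  open import Relation.Nullary.Negation using (¬_; contradiction)
  open import Defs using (Σℤ; Σℕ; count; isOdd)
  open import Algebra.Properties.Semiring.Sum +-*-semiring public

  [_] : Bool → Parity
  [ true ]  = 1ℙ
  [ false ] = 0ℙ

  [∧] : ∀ a b → [ a ∧ b ] ≡ [ a ] * [ b ]
  [∧] true  b = refl
  [∧] false b = refl

  parity-if : ∀ b m → parity (if b then m else 0) ≡ [ b ] * parity m
  parity-if true  m = refl
  parity-if false m = refl

  parity-Σℕ : ∀ {n} (h : Fin n → ℕ) → parity (Σℕ h) ≡ ∑[ i < n ] parity (h i)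
  parity-Σℕ {zero}  h = refl
  parity-Σℕ {suc n} h =
    trans (+-homo-+ (h zero) _) (cong (parity (h zero) +_) (parity-Σℕ (λ i → h (suc i))))

  parity-count : ∀ {n} (p : Fin n → Bool) → parity (count p) ≡ ∑[ i < n ] [ p i ]
  parity-count {zero}  p = refl
  parity-count {suc n} p = trans (+-homo-+ (if p zero then 1 else 0) _)
    (cong₂ _+_ (parity-indicator (p zero)) (parity-count (λ i → p (suc i))))
    where
    parity-indicator : ∀ b → parity (if b then 1 else 0) ≡ [ b ]
    parity-indicator true  = refl
    parity-indicator false = refl

  parity-Σℕ-over : ∀ {n} (C : Fin n → Bool) (h : Fin n → ℕ) {p : Fin n → Parity} →
    (∀ i → parity (h i) ≡ p i) →
    parity (Σℕ (λ i → if C i then h i else 0)) ≡ ∑[ i < n ] ([ C i ] * p i)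
  parity-Σℕ-over C h parity-h = trans (parity-Σℕ (λ i → if C i then h i else 0))
    (sum-cong-≗ (λ i → trans (parity-if (C i) (h i)) (cong ([ C i ] *_) (parity-h i))))

  Σℤ≡+Σℕ : ∀ {n} {z : Fin n → ℤ.ℤ} {h : Fin n → ℕ} → (∀ i → z i ≡ ℤ.+ h i) → Σℤ z ≡ ℤ.+ Σℕ h
  Σℤ≡+Σℕ {zero}  z≡h = refl
  Σℤ≡+Σℕ {suc n} z≡h =
    cong₂ ℤ._+_ (z≡h zero) (Σℤ≡+Σℕ (λ i → z≡h (suc i)))

  [isOdd]-pos : ∀ m → [ isOdd (ℤ.+ m) ] ≡ parity m
  [isOdd]-pos zero          = refl
  [isOdd]-pos (suc zero)    = refl
  [isOdd]-pos (suc (suc m)) = [isOdd]-pos m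

  parity≡0ℙ⇒2∣ : ∀ m → parity m ≡ 0ℙ → 2 ∣ℕ m
  parity≡0ℙ⇒2∣ zero          _  = divides 0 refl
  parity≡0ℙ⇒2∣ (suc (suc m)) eq with divides q m≡q*2 ← parity≡0ℙ⇒2∣ m eq =
    divides (suc q) (cong (λ x → suc (suc x)) m≡q*2)

  2∣alternating-sum : ∀ a b c d → parity (a ℕ.+ b ℕ.+ c ℕ.+ d) ≡ 0ℙ →
                      ℤ.+ 2 ∣ ℤ.+ a ℤ.- ℤ.+ b ℤ.+ ℤ.+ c ℤ.- ℤ.+ d
  2∣alternating-sum a b c d even =
    Signed.∣⇒∣ᵤ (subst (Signed._∣_ (ℤ.+ 2)) (sym rearranged)
      (Signed.∣m∣n⇒∣m-n (Signed.∣ᵤ⇒∣ {i = ℤ.+ (a ℕ.+ b ℕ.+ c ℕ.+ d)} (parity≡0ℙ⇒2∣ _ even))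
                        (Signed.∣n⇒∣m*n (ℤ.+ b ℤ.+ ℤ.+ d) Signed.∣-refl)))
    where
    shuffle : ∀ a b c d →
              a ℤ.- b ℤ.+ c ℤ.- d ≡ (a ℤ.+ b ℤ.+ c ℤ.+ d) ℤ.- (b ℤ.+ d) ℤ.* ℤ.+ 2
    shuffle = solve-∀
    rearranged : ℤ.+ a ℤ.- ℤ.+ b ℤ.+ ℤ.+ c ℤ.- ℤ.+ d ≡
                 ℤ.+ (a ℕ.+ b ℕ.+ c ℕ.+ d) ℤ.- (ℤ.+ b ℤ.+ ℤ.+ d) ℤ.* ℤ.+ 2
    rearranged = trans (shuffle (ℤ.+ a) (ℤ.+ b) (ℤ.+ c) (ℤ.+ d))
      (cong (ℤ._- (ℤ.+ b ℤ.+ ℤ.+ d) ℤ.* ℤ.+ 2) (sym (trans (ℤ.pos-+ (a ℕ.+ b ℕ.+ c) d)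
        (cong (ℤ._+ ℤ.+ d) (trans (ℤ.pos-+ (a ℕ.+ b) c) (cong (ℤ._+ ℤ.+ c) (ℤ.pos-+ a b)))))))

  2∣⇒parity≡0ℙ : ∀ {m} → 2 ∣ℕ m → parity m ≡ 0ℙ
  2∣⇒parity≡0ℙ (divides q refl) = trans (*-homo-* q 2) (*-zeroʳ (parity q))

  []-partition : ∀ x y → x ∧ y ≡ false → [ x ] + [ y ] + [ not (x ∨ y) ] ≡ 1ℙ
  []-partition true  false _ = refl
  []-partition false true  _ = refl
  []-partition false false _ = refl

  [not]-split : ∀ x y → x ∧ y ≡ false → [ not x ] ≡ [ y ] + [ not (x ∨ y) ]
  [not]-split true  false _ = refl
  [not]-split false true  _ = refl
  [not]-split false false _ = refl

  x+y+[y+z]≡x+z : ∀ x y z → (x + y) + (y + z) ≡ x + z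
  x+y+[y+z]≡x+z x y z = begin
    (x + y) + (y + z) ≡⟨ +-assoc x y (y + z) ⟩
    x + (y + (y + z)) ≡⟨ cong (x +_) (sym (+-assoc y y z)) ⟩
    x + ((y + y) + z) ≡⟨ cong (λ w → x + (w + z)) (p+p≡0ℙ y) ⟩
    x + z             ∎
    where open ≡-Reasoning

  []-T : ∀ {b} → T b → [ b ] ≡ 1ℙ
  []-T {true} _ = refl

  []-¬T : ∀ {b} → ¬ T b → [ b ] ≡ 0ℙ
  []-¬T {true}  ¬t = contradiction _ ¬t
  []-¬T {false} _  = refl

  ∑-[]-none : ∀ {n} (p : Fin n → Bool) → (∀ i → ¬ T (p i)) → ∑[ i < n ] [ p i ] ≡ 0ℙ
  ∑-[]-none {n} p none = trans (sum-cong-≗ [p]≡0) (sum-replicate-zero n)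
    where
    [p]≡0 : ∀ i → [ p i ] ≡ 0ℙ
    [p]≡0 i = []-¬T (none i)

  ∑-[]-unique : ∀ {n} (p : Fin n → Bool) i → T (p i) → (∀ j → T (p j) → j ≡ i) →
                ∑[ j < n ] [ p j ] ≡ 1ℙ
  ∑-[]-unique {suc n} p i pi unique = begin
    ∑[ j < suc n ] [ p j ]                   ≡⟨ sum-remove {i = i} (λ j → [ p j ]) ⟩
    [ p i ] + ∑[ j < n ] [ p (punchIn i j) ] ≡⟨ cong₂ _+_ ([]-T pi) (∑-[]-none _ others) ⟩
    1ℙ + 0ℙ                                  ∎
    where
    open ≡-Reasoning
    others : ∀ j → ¬ T (p (punchIn i j))
    others j pj = punchInᵢ≢i i j (unique _ pj)

  ∑∑-symmetric≡∑-diagonal : ∀ {n} (M : Fin n → Fin n → Parity) → (∀ i j → M i j ≡ M j i) →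
    ∑[ i < n ] ∑[ j < n ] M i j ≡ ∑[ i < n ] M i i
  ∑∑-symmetric≡∑-diagonal {zero}  M sym-M = refl
  ∑∑-symmetric≡∑-diagonal {suc n} M sym-M = begin
    (M zero zero + row) + ∑[ i < n ] (M (suc i) zero + ∑[ j < n ] M (suc i) (suc j))
      ≡⟨ cong ((M zero zero + row) +_) (∑-distrib-+ (λ i → M (suc i) zero) _) ⟩
    (M zero zero + row) + (column + rest)
      ≡⟨ cong (λ c → (M zero zero + row) + (c + rest)) column≡row ⟩
    (M zero zero + row) + (row + rest)
      ≡⟨ x+y+[y+z]≡x+z (M zero zero) row rest ⟩
    M zero zero + rest
      ≡⟨ cong (M zero zero +_) (∑∑-symmetric≡∑-diagonal (λ i j → M (suc i) (suc j))
                                                        (λ i j → sym-M (suc i) (suc j))) ⟩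
    M zero zero + ∑[ i < n ] M (suc i) (suc i) ∎
    where
    open ≡-Reasoning
    row column rest : Parity
    row    = ∑[ j < n ] M zero (suc j)
    column = ∑[ i < n ] M (suc i) zero
    rest   = ∑[ i < n ] ∑[ j < n ] M (suc i) (suc j)
    column≡row : column ≡ row
    column≡row = sum-cong-≗ (λ i → sym-M (suc i) zero)

module FinSubsets where

  open import Data.Bool.Base using (Bool; true; false; not; T)
  open import Data.Bool.Properties using (T-∨; T-≡; T?)
  open import Data.Nat.Base using (ℕ; zero; suc; _≤_; _<_; _+_; _∸_; z≤n; s≤s; s≤s⁻¹)
  open import Data.Nat.Properties
    using (m≤n⇒m≤1+n; m<n⇒m<1+n; n<1+n; ≤-trans; <-irrefl; m≤m+n; m∸n+n≡m)
  open import Data.Fin.Base using (Fin; zero; suc)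
  open import Data.Fin.Properties using (any?)
  open import Data.Product using (∃-syntax; _×_; _,_)
  open import Data.Sum using (_⊎_; inj₁; inj₂)
  open import Data.Empty using (⊥-elim)
  open import Function.Base using (id; _∘_)
  open import Function.Bundles using (Equivalence; _⇔_; mk⇔)
  open import Relation.Nullary using (¬_; yes; no)
  open import Relation.Nullary.Decidable using (_×-dec_; ¬?; decidable-stable)
  open import Relation.Binary.PropositionalEquality using (refl; subst)
  open import Defs using (VSet; count; any; all)

  infix 4 _⊆_
  _⊆_ : ∀ {n} → VSet n → VSet n → Set
  S ⊆ S′ = ∀ {v} → T (S v) → T (S′ v)

  T-not : ∀ {b} → T (not b) ⇔ (¬ T b)
  T-not {true}  = mk⇔ (λ ()) (λ ¬t → ¬t _)
  T-not {false} = mk⇔ (λ _ ()) (λ _ → _)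

  any⁺ : ∀ {n} (p : Fin n → Bool) {i} → T (p i) → T (any p)
  any⁺ p {zero}  pi = Equivalence.from T-∨ (inj₁ pi)
  any⁺ p {suc i} pi = Equivalence.from T-∨ (inj₂ (any⁺ (λ j → p (suc j)) pi))

  any⁻ : ∀ {n} (p : Fin n → Bool) → T (any p) → ∃[ i ] T (p i)
  any⁻ {suc n} p h with Equivalence.to T-∨ h
  ... | inj₁ p0 = zero , p0
  ... | inj₂ ps with any⁻ (λ j → p (suc j)) ps
  ...   | i , pi = suc i , pi

  all⁺ : ∀ {n} (p : Fin n → Bool) → (∀ i → T (p i)) → T (all p)
  all⁺ p all-p with any (λ i → not (p i)) in e
  ... | false = _
  ... | true with any⁻ _ (Equivalence.from T-≡ e)
  ...   | i , ¬pi = ⊥-elim (Equivalence.to T-not ¬pi (all-p i))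

  count-≤ : ∀ {n} (p : Fin n → Bool) → count p ≤ n
  count-≤ {zero}  p = z≤n
  count-≤ {suc n} p with p zero
  ... | true  = s≤s (count-≤ _)
  ... | false = m≤n⇒m≤1+n (count-≤ _)

  count-mono : ∀ {n} {S S′ : VSet n} → S ⊆ S′ → count S ≤ count S′
  count-mono {zero}          S⊆S′ = z≤n
  count-mono {suc n} {S} {S′} S⊆S′ with S zero | S′ zero | S⊆S′ {zero}
  ... | true  | true  | _ = s≤s (count-mono {S = S ∘ suc} {S′ ∘ suc} S⊆S′)
  ... | true  | false | f = ⊥-elim (f _)
  ... | false | true  | _ = m≤n⇒m≤1+n (count-mono {S = S ∘ suc} {S′ ∘ suc} S⊆S′)
  ... | false | false | _ = count-mono {S = S ∘ suc} {S′ ∘ suc} S⊆S′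

  count-< : ∀ {n} {S S′ : VSet n} → S ⊆ S′ → ∀ {v} → ¬ T (S v) → T (S′ v) → count S < count S′
  count-< {suc n} {S} {S′} S⊆S′ {zero} ¬Sv S′v with S zero | S′ zero | S⊆S′ {zero}
  ... | false | true  | _ = s≤s (count-mono {S = S ∘ suc} {S′ ∘ suc} S⊆S′)
  ... | true  | _     | _ = ⊥-elim (¬Sv _)
  count-< {suc n} {S} {S′} S⊆S′ {suc v} ¬Sv S′v with S zero | S′ zero | S⊆S′ {zero}
  ... | true  | true  | _ = s≤s (count-< {S = S ∘ suc} {S′ ∘ suc} S⊆S′ ¬Sv S′v)
  ... | true  | false | f = ⊥-elim (f _)
  ... | false | true  | _ = m≤n⇒m≤1+n (count-< {S = S ∘ suc} {S′ ∘ suc} S⊆S′ ¬Sv S′v)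
  ... | false | false | _ = count-< {S = S ∘ suc} {S′ ∘ suc} S⊆S′ ¬Sv S′v

  ⊆-or-new : ∀ {n} (S S′ : VSet n) → S ⊆ S′ ⊎ ∃[ v ] (T (S v) × ¬ T (S′ v))
  ⊆-or-new S S′ with any? (λ v → T? (S v) ×-dec ¬? (T? (S′ v)))
  ... | yes new = inj₂ new
  ... | no ¬new = inj₁ λ {v} Sv → decidable-stable (T? (S′ v)) (λ ¬S′v → ¬new (v , Sv , ¬S′v))

  module IncreasingChain {n} (S : ℕ → VSet n)
           (increasing : ∀ k → S k ⊆ S (suc k))
           (stall-persists : ∀ k → S (suc k) ⊆ S k → S (suc (suc k)) ⊆ S (suc k)) where

    increasing-by : ∀ d k → S k ⊆ S (d + k)
    increasing-by zero    k = id
    increasing-by (suc d) k = increasing (d + k) ∘ increasing-by d k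

    mono : ∀ {k m} → k ≤ m → S k ⊆ S m
    mono {k} {m} k≤m = subst (λ i → S k ⊆ S i) (m∸n+n≡m k≤m) (increasing-by (m ∸ k) k)

    stalled-forever : ∀ {j} → S (suc j) ⊆ S j → ∀ d → S (d + j) ⊆ S j
    stalled-forever {j} stall d = settle d
      where
      stalled : ∀ d → S (suc (d + j)) ⊆ S (d + j)
      stalled zero    = stall
      stalled (suc d) = stall-persists (d + j) (stalled d)
      settle : ∀ d → S (d + j) ⊆ S j
      settle zero    = id
      settle (suc d) = settle d ∘ stalled d

    stalls-or-grows : ∀ j → (∃[ i ] (i < j × S (suc i) ⊆ S i)) ⊎ j ≤ count (S j)
    stalls-or-grows zero = inj₂ z≤n
    stalls-or-grows (suc j) with stalls-or-grows j
    ... | inj₁ (i , i<j , stall) = inj₁ (i , m<n⇒m<1+n i<j , stall)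
    ... | inj₂ j≤∣Sj∣ with ⊆-or-new (S (suc j)) (S j)
    ...   | inj₁ stall              = inj₁ (j , n<1+n j , stall)
    ...   | inj₂ (v , new , ¬old) =
      inj₂ (≤-trans (s≤s j≤∣Sj∣) (count-< {S = S j} {S (suc j)} (increasing j) ¬old new))

    stalls-by-n : ∃[ j ] (j ≤ n × S (suc j) ⊆ S j)
    stalls-by-n with stalls-or-grows (suc n)
    ... | inj₁ (j , j<1+n , stall) = j , s≤s⁻¹ j<1+n , stall
    ... | inj₂ 1+n≤∣S∣             = ⊥-elim (<-irrefl refl (≤-trans 1+n≤∣S∣ (count-≤ (S (suc n)))))

    ⊆-S-n : ∀ m → S m ⊆ S n
    ⊆-S-n m with stalls-by-n
    ... | j , j≤n , stall = mono j≤n ∘ stalled-forever stall m ∘ mono (m≤m+n m j)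

module Components {n} (G : Defs.Graph n) (R : Defs.VSet n) where

  open import Data.Bool.Base using (Bool; not; _∧_; T)
  open import Data.Bool.Properties using (T-∧; T-∨; T?)
  open import Data.Nat.Base as ℕ using (ℕ; zero; suc)
  open import Data.Nat.Properties as ℕ using ()
  open import Data.Fin.Base using (Fin; _<_)
  open import Data.Fin.Properties using (<-cmp; _≟_; _<?_)
  open import Data.Fin.Induction using (<-wellFounded)
  open import Data.Parity.Base using (Parity; _*_)
  open import Data.Parity.Properties using (*-assoc)
  open import Data.Product using (∃-syntax; _×_; _,_; proj₁; proj₂)
  open import Data.Sum using (inj₁; inj₂)
  open import Data.Empty using (⊥-elim)
  open import Function.Base using (_∘_)
  open import Function.Bundles using (module Equivalence)
  open import Induction.WellFounded using (Acc; acc)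
  open import Relation.Binary.Definitions using (tri<; tri≈; tri>)
  open import Relation.Binary.PropositionalEquality
    using (_≡_; refl; sym; trans; cong; subst; module ≡-Reasoning)
  open import Relation.Nullary using (¬_; yes; no)
  open import Relation.Nullary.Decidable using (⌊_⌋; toWitness; fromWitness)
  open import Defs using (Graph; adj; reach; sameComp; any)
  open Equivalence using (to; from)
  open FinSubsets
  open Mod2

  data Reach : ℕ → Fin n → Fin n → Set where
    start : ∀ {v} → T (R v) → Reach 0 v v
    stay  : ∀ {k u v} → Reach k u v → Reach (suc k) u v
    step  : ∀ {k u w v} → Reach k u w → T (adj G w v) → T (R v) → Reach (suc k) u v

  reach⁻ : ∀ k {u v} → T (reach G R k u v) → Reach k u v
  reach⁻ zero {u} {v} h with to (T-∧ {R u}) h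
  ... | Ru , h′ with toWitness {a? = u ≟ v} (proj₂ (to (T-∧ {R v}) h′))
  ...   | refl = start Ru
  reach⁻ (suc k) {u} {v} h with to (T-∨ {reach G R k u v}) h
  ... | inj₁ short = stay (reach⁻ k short)
  ... | inj₂ via with any⁻ (λ w → reach G R k u w ∧ adj G w v ∧ R v) via
  ...   | w , uwv with to (T-∧ {reach G R k u w}) uwv
  ...     | uw , wv with to (T-∧ {adj G w v}) wv
  ...       | edge , Rv = step (reach⁻ k uw) edge Rv

  reach⁺ : ∀ {k u v} → Reach k u v → T (reach G R k u v)
  reach⁺ {v = v} (start Rv) =
    from (T-∧ {R v}) (Rv , from (T-∧ {R v}) (Rv , fromWitness {a? = v ≟ v} refl))
  reach⁺ {suc k} {u} {v} (stay r) = from (T-∨ {reach G R k u v}) (inj₁ (reach⁺ r))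
  reach⁺ {suc k} {u} {v} (step {w = w} r edge Rv) =
    from (T-∨ {reach G R k u v}) (inj₂ (any⁺ (λ x → reach G R k u x ∧ adj G x v ∧ R v)
      (from (T-∧ {reach G R k u w}) (reach⁺ r , from (T-∧ {adj G w v}) (edge , Rv)))))

  Reach-inside : ∀ {k u v} → Reach k u v → T (R u) × T (R v)
  Reach-inside (start Rv)     = Rv , Rv
  Reach-inside (stay r)       = Reach-inside r
  Reach-inside (step r _ Rv)  = proj₁ (Reach-inside r) , Rv

  Reach-trans : ∀ {a b u w v} → Reach a u w → Reach b w v → Reach (b ℕ.+ a) u v
  Reach-trans uw (start _)        = uw
  Reach-trans uw (stay wv)        = stay (Reach-trans uw wv)
  Reach-trans uw (step wx edge Rv) = step (Reach-trans uw wx) edge Rv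

  Reach-sym : ∀ {k u v} → Reach k u v → Reach k v u
  Reach-sym (start Rv)                = start Rv
  Reach-sym (stay r)                  = stay (Reach-sym r)
  Reach-sym {suc k} {u} {v} (step ux edge Rv) =
    subst (λ i → Reach i v u) (ℕ.+-comm k 1) (Reach-trans vx (Reach-sym ux))
    where
    vx = step (start Rv) (subst T (Graph.sym G _ _) edge) (proj₂ (Reach-inside ux))

  reach-stall-persists : ∀ {u} k → reach G R (suc k) u ⊆ reach G R k u →
                         reach G R (suc (suc k)) u ⊆ reach G R (suc k) u
  reach-stall-persists k stall h with reach⁻ (suc (suc k)) h
  ... | stay r          = reach⁺ r
  ... | step uw edge Rv = reach⁺ (step (reach⁻ k (stall (reach⁺ uw))) edge Rv)

  -- sameComp only looks at walks of length ≤ n; longer walks are shortened because the sets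
  -- reachable from u in ≤ k steps grow with k and stay fixed once they stop growing.
  Reach⇒sameComp : ∀ {m u v} → Reach m u v → T (sameComp G R u v)
  Reach⇒sameComp {m} {u} r =
    IncreasingChain.⊆-S-n (λ k → reach G R k u) (λ k → reach⁺ ∘ stay ∘ reach⁻ k) reach-stall-persists
                          m (reach⁺ r)

  sameComp⁻ : ∀ {u v} → T (sameComp G R u v) → Reach n u v
  sameComp⁻ = reach⁻ n

  sameComp-refl : ∀ {v} → T (R v) → T (sameComp G R v v)
  sameComp-refl Rv = Reach⇒sameComp (start Rv)

  sameComp-sym : ∀ {u v} → T (sameComp G R u v) → T (sameComp G R v u)
  sameComp-sym uv = Reach⇒sameComp (Reach-sym (sameComp⁻ uv))

  sameComp-trans : ∀ {u w v} → T (sameComp G R u w) → T (sameComp G R w v) → T (sameComp G R u v)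
  sameComp-trans uw wv = Reach⇒sameComp (Reach-trans (sameComp⁻ uw) (sameComp⁻ wv))

  sameComp-inside : ∀ {u v} → T (sameComp G R u v) → T (R u) × T (R v)
  sameComp-inside = Reach-inside ∘ sameComp⁻

  isRep : Fin n → Bool
  isRep r = R r ∧ not (any (λ u → ⌊ u <? r ⌋ ∧ sameComp G R u r))

  isRep-least : ∀ {r u} → T (isRep r) → u < r → ¬ T (sameComp G R u r)
  isRep-least {r} {u} rep u<r ur =
    to T-not (proj₂ (to (T-∧ {R r}) rep))
      (any⁺ (λ u → ⌊ u <? r ⌋ ∧ sameComp G R u r) (from (T-∧ {⌊ u <? r ⌋}) (fromWitness u<r , ur)))

  isRep-unique : ∀ {r₁ r₂ v} → T (isRep r₁) → T (isRep r₂) →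
                 T (sameComp G R r₁ v) → T (sameComp G R r₂ v) → r₁ ≡ r₂
  isRep-unique {r₁} {r₂} rep₁ rep₂ r₁v r₂v with <-cmp r₁ r₂
  ... | tri< r₁<r₂ _ _ = ⊥-elim (isRep-least rep₂ r₁<r₂ (sameComp-trans r₁v (sameComp-sym r₂v)))
  ... | tri≈ _ r₁≡r₂ _ = r₁≡r₂
  ... | tri> _ _ r₂<r₁ = ⊥-elim (isRep-least rep₁ r₂<r₁ (sameComp-trans r₂v (sameComp-sym r₁v)))

  isRep-exists : ∀ {r v} → Acc _<_ r → T (sameComp G R r v) →
                 ∃[ r′ ] (T (isRep r′) × T (sameComp G R r′ v))
  isRep-exists {r} (acc smaller) rv with T? (any (λ u → ⌊ u <? r ⌋ ∧ sameComp G R u r))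
  ... | no ¬earlier = r , from (T-∧ {R r}) (proj₁ (sameComp-inside rv) , from T-not ¬earlier) , rv
  ... | yes earlier with any⁻ (λ u → ⌊ u <? r ⌋ ∧ sameComp G R u r) earlier
  ...   | u , h with to (T-∧ {⌊ u <? r ⌋}) h
  ...     | u<r , ur = isRep-exists (smaller (toWitness u<r)) (sameComp-trans ur rv)

  ∑-isRep-of : ∀ v → ∑[ r < n ] [ isRep r ∧ sameComp G R r v ] ≡ [ R v ]
  ∑-isRep-of v with T? (R v)
  ... | no ¬Rv =
    trans (∑-[]-none _ (λ r h → ¬Rv (proj₂ (sameComp-inside (proj₂ (to (T-∧ {isRep r}) h))))))
          (sym ([]-¬T ¬Rv))
  ... | yes Rv with isRep-exists (<-wellFounded v) (sameComp-refl Rv)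
  ...   | r , rep , rv = trans (∑-[]-unique _ r (from (T-∧ {isRep r}) (rep , rv)) unique) (sym ([]-T Rv))
    where
    unique : ∀ r′ → T (isRep r′ ∧ sameComp G R r′ v) → r′ ≡ r
    unique r′ h = isRep-unique (proj₁ (to (T-∧ {isRep r′}) h)) rep (proj₂ (to (T-∧ {isRep r′}) h)) rv

  ∑-over-components : (φ : Fin n → Parity) →
    ∑[ r < n ] ([ isRep r ] * ∑[ v < n ] ([ sameComp G R r v ] * φ v)) ≡ ∑[ v < n ] ([ R v ] * φ v)
  ∑-over-components φ = begin
    ∑[ r < n ] ([ isRep r ] * ∑[ v < n ] ([ sameComp G R r v ] * φ v))
      ≡⟨ sum-cong-≗ (λ r → *-distribˡ-sum [ isRep r ] (λ v → [ sameComp G R r v ] * φ v)) ⟩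
    ∑[ r < n ] ∑[ v < n ] ([ isRep r ] * ([ sameComp G R r v ] * φ v))
      ≡⟨ ∑-comm (λ r v → [ isRep r ] * ([ sameComp G R r v ] * φ v)) ⟩
    ∑[ v < n ] ∑[ r < n ] ([ isRep r ] * ([ sameComp G R r v ] * φ v))
      ≡⟨ sum-cong-≗ (λ v → sum-cong-≗ (λ r → reassociate r v)) ⟩
    ∑[ v < n ] ∑[ r < n ] ([ isRep r ∧ sameComp G R r v ] * φ v)
      ≡⟨ sum-cong-≗ (λ v → sym (*-distribʳ-sum (φ v) (λ r → [ isRep r ∧ sameComp G R r v ]))) ⟩
    ∑[ v < n ] (∑[ r < n ] [ isRep r ∧ sameComp G R r v ] * φ v)
      ≡⟨ sum-cong-≗ (λ v → cong (_* φ v) (∑-isRep-of v)) ⟩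
    ∑[ v < n ] ([ R v ] * φ v) ∎
    where
    open ≡-Reasoning
    reassociate : ∀ r v → [ isRep r ] * ([ sameComp G R r v ] * φ v) ≡ [ isRep r ∧ sameComp G R r v ] * φ v
    reassociate r v = sym (trans (cong (_* φ v) ([∧] (isRep r) (sameComp G R r v)))
                                 (*-assoc [ isRep r ] [ sameComp G R r v ] (φ v)))

module Deficiency {n} (G : Defs.Graph n) (X : Defs.VSet n) (k : ℕ) (A B : Defs.VSet n)
                  (A∩B=∅ : Defs.Disjoint A B) where

  open import Data.Bool.Base using (Bool; true; false; not; _∧_; _∨_; if_then_else_; T)
  open import Data.Nat.Base as ℕ using (ℕ; parity)
  open import Data.Integer.Base as ℤ using (ℤ)
  import Data.Integer.Properties as ℤ
  open import Data.Fin.Base using (Fin)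
  open import Data.Parity.Base using (Parity; 0ℙ; _+_; _*_)
  open import Data.Parity.Properties
    using (+-comm; *-zeroʳ; *-identityʳ; *-distribˡ-+; *-distribʳ-+; *-commutativeSemigroup; +-homo-+; *-homo-*)
  open import Algebra.Properties.CommutativeSemigroup *-commutativeSemigroup using (x∙yz≈z∙yx)
  open import Relation.Binary.PropositionalEquality
    using (_≡_; refl; sym; trans; cong; cong₂; module ≡-Reasoning)
  open import Relation.Nullary.Decidable using (⌊_⌋; fromWitness)
  open import Defs
    using (Graph; adj; irrefl; VSet; Σℤ; Σℕ; count; all; isOdd; sameComp; eComp; degMinus; hW; δ)
  open Mod2
  open FinSubsets using (all⁺)
  open ≡-Reasoning

  f g : Fin n → ℤ
  f v = if X v then ℤ.+ 2 else ℤ.+ k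
  g v = if X v then ℤ.+ 0 else ℤ.+ k

  fℕ gℕ : Fin n → ℕ
  fℕ v = if X v then 2 else k
  gℕ v = if X v then 0 else k

  R : VSet n
  R v = not (A v ∨ B v)

  open Components G R

  π : Fin n → Parity
  π v = parity k * [ not (X v) ]

  N : Fin n → Parity
  N v = ∑[ w < n ] [ adj G v w ∧ B w ]

  a b c d : ℕ
  a = Σℕ (λ v → if A v then fℕ v else 0)
  b = Σℕ (λ v → if B v then gℕ v else 0)
  c = Σℕ (λ v → if B v then degMinus G A v else 0)
  d = hW G X f g A B

  f≡+fℕ : ∀ v → f v ≡ ℤ.+ fℕ v
  f≡+fℕ v with X v
  ... | true  = refl
  ... | false = refl

  g≡+gℕ : ∀ v → g v ≡ ℤ.+ gℕ v
  g≡+gℕ v with X v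
  ... | true  = refl
  ... | false = refl

  Σℤ-over : ∀ (C : VSet n) (z : Fin n → ℤ) (h : Fin n → ℕ) → (∀ v → z v ≡ ℤ.+ h v) →
            Σℤ (λ v → if C v then z v else ℤ.+ 0) ≡ ℤ.+ Σℕ (λ v → if C v then h v else 0)
  Σℤ-over C z h z≡h = Σℤ≡+Σℕ over
    where
    over : ∀ v → (if C v then z v else ℤ.+ 0) ≡ ℤ.+ (if C v then h v else 0)
    over v with C v
    ... | true  = z≡h v
    ... | false = refl

  δ≡alternating : δ G X f g A B ≡ ℤ.+ a ℤ.- ℤ.+ b ℤ.+ ℤ.+ c ℤ.- ℤ.+ d
  δ≡alternating =
    cong₂ (λ x y → x ℤ.- y ℤ.+ ℤ.+ c ℤ.- ℤ.+ d) (Σℤ-over A f fℕ f≡+fℕ) (Σℤ-over B g gℕ g≡+gℕ)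

  parity-fℕ : ∀ v → parity (fℕ v) ≡ π v
  parity-fℕ v with X v
  ... | true  = sym (*-zeroʳ (parity k))
  ... | false = sym (*-identityʳ (parity k))

  parity-gℕ : ∀ v → parity (gℕ v) ≡ π v
  parity-gℕ v with X v
  ... | true  = sym (*-zeroʳ (parity k))
  ... | false = sym (*-identityʳ (parity k))

  parity-a : parity a ≡ ∑[ v < n ] ([ A v ] * π v)
  parity-a = parity-Σℕ-over A fℕ parity-fℕ

  parity-b : parity b ≡ ∑[ v < n ] ([ B v ] * π v)
  parity-b = parity-Σℕ-over B gℕ parity-gℕ

  edge : VSet n → VSet n → Fin n → Fin n → Parity
  edge S S′ v u = [ S v ] * [ adj G v u ∧ S′ u ]

  edge-swap : ∀ (S S′ : VSet n) v u → edge S S′ v u ≡ edge S′ S u v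
  edge-swap S S′ v u = begin
    [ S v ] * [ adj G v u ∧ S′ u ]          ≡⟨ cong ([ S v ] *_) ([∧] (adj G v u) (S′ u)) ⟩
    [ S v ] * ([ adj G v u ] * [ S′ u ])    ≡⟨ x∙yz≈z∙yx [ S v ] [ adj G v u ] [ S′ u ] ⟩
    [ S′ u ] * ([ adj G v u ] * [ S v ])    ≡⟨ cong (λ e → [ S′ u ] * ([ e ] * [ S v ])) (Graph.sym G v u) ⟩
    [ S′ u ] * ([ adj G u v ] * [ S v ])    ≡⟨ cong ([ S′ u ] *_) ([∧] (adj G u v) (S v)) ⟨
    [ S′ u ] * [ adj G u v ∧ S v ]          ∎

  edge-split : ∀ v u → [ B v ] * [ adj G v u ∧ not (A u) ] ≡ edge B B v u + edge B R v u
  edge-split v u = begin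
    [ B v ] * [ adj G v u ∧ not (A u) ]
      ≡⟨ cong ([ B v ] *_) ([∧] (adj G v u) (not (A u))) ⟩
    [ B v ] * ([ adj G v u ] * [ not (A u) ])
      ≡⟨ cong (λ p → [ B v ] * ([ adj G v u ] * p)) ([not]-split (A u) (B u) (A∩B=∅ u)) ⟩
    [ B v ] * ([ adj G v u ] * ([ B u ] + [ R u ]))
      ≡⟨ cong ([ B v ] *_) (*-distribˡ-+ [ adj G v u ] [ B u ] [ R u ]) ⟩
    [ B v ] * (([ adj G v u ] * [ B u ]) + ([ adj G v u ] * [ R u ]))
      ≡⟨ cong ([ B v ] *_) (cong₂ _+_ ([∧] (adj G v u) (B u)) ([∧] (adj G v u) (R u))) ⟨
    [ B v ] * ([ adj G v u ∧ B u ] + [ adj G v u ∧ R u ])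
      ≡⟨ *-distribˡ-+ [ B v ] [ adj G v u ∧ B u ] [ adj G v u ∧ R u ] ⟩
    edge B B v u + edge B R v u ∎

  B-B-edges : ∑[ v < n ] ∑[ u < n ] edge B B v u ≡ 0ℙ
  B-B-edges = begin
    ∑[ v < n ] ∑[ u < n ] edge B B v u ≡⟨ ∑∑-symmetric≡∑-diagonal (edge B B) (edge-swap B B) ⟩
    ∑[ v < n ] edge B B v v            ≡⟨ sum-cong-≗ no-loop ⟩
    ∑[ v < n ] 0ℙ                      ≡⟨ sum-replicate-zero n ⟩
    0ℙ                                 ∎
    where
    no-loop : ∀ v → edge B B v v ≡ 0ℙ
    no-loop v = trans (cong (λ e → [ B v ] * [ e ∧ B v ]) (irrefl G v)) (*-zeroʳ [ B v ])

  B-R-edges : ∑[ v < n ] ∑[ u < n ] edge B R v u ≡ ∑[ u < n ] ([ R u ] * N u)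
  B-R-edges = begin
    ∑[ v < n ] ∑[ u < n ] edge B R v u
      ≡⟨ ∑-comm (edge B R) ⟩
    ∑[ u < n ] ∑[ v < n ] edge B R v u
      ≡⟨ sum-cong-≗ (λ u → sum-cong-≗ (λ v → edge-swap B R v u)) ⟩
    ∑[ u < n ] ∑[ v < n ] ([ R u ] * [ adj G u v ∧ B v ])
      ≡⟨ sum-cong-≗ (λ u → *-distribˡ-sum [ R u ] (λ v → [ adj G u v ∧ B v ])) ⟨
    ∑[ u < n ] ([ R u ] * N u) ∎

  parity-c : parity c ≡ ∑[ v < n ] ([ R v ] * N v)
  parity-c = begin
    parity c
      ≡⟨ parity-Σℕ-over B (degMinus G A) (λ v → parity-count (λ u → adj G v u ∧ not (A u))) ⟩
    ∑[ v < n ] ([ B v ] * ∑[ u < n ] [ adj G v u ∧ not (A u) ])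
      ≡⟨ sum-cong-≗ (λ v → *-distribˡ-sum [ B v ] (λ u → [ adj G v u ∧ not (A u) ])) ⟩
    ∑[ v < n ] ∑[ u < n ] ([ B v ] * [ adj G v u ∧ not (A u) ])
      ≡⟨ sum-cong-≗ (λ v → trans (sum-cong-≗ (edge-split v)) (∑-distrib-+ (edge B B v) (edge B R v))) ⟩
    ∑[ v < n ] (∑[ u < n ] edge B B v u + ∑[ u < n ] edge B R v u)
      ≡⟨ ∑-distrib-+ (λ v → ∑[ u < n ] edge B B v u) (λ v → ∑[ u < n ] edge B R v u) ⟩
    ∑[ v < n ] ∑[ u < n ] edge B B v u + ∑[ v < n ] ∑[ u < n ] edge B R v u
      ≡⟨ cong₂ _+_ B-B-edges B-R-edges ⟩
    ∑[ v < n ] ([ R v ] * N v) ∎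

  -- The two tests inside hW, restated so that hW G X f g A B unfolds to
  -- count (λ r → isRep r ∧ agreesOffW r ∧ oddComp r).
  agreesOffW oddComp : Fin n → Bool
  agreesOffW r = all (λ v → not (sameComp G R r v ∧ not (X v)) ∨ ⌊ g v ℤ.≟ f v ⌋)
  oddComp r = isOdd (Σℤ (λ v → if sameComp G R r v then f v else ℤ.+ 0) ℤ.+ ℤ.+ eComp G R r B)

  agreesOffW-holds : ∀ r → T (agreesOffW r)
  agreesOffW-holds r = all⁺ _ (λ v → off-X (X v) (sameComp G R r v))
    where
    off-X : ∀ x s →
      T (not (s ∧ not x) ∨ ⌊ (if x then ℤ.+ 0 else ℤ.+ k) ℤ.≟ (if x then ℤ.+ 2 else ℤ.+ k) ⌋)
    off-X true  true  = _
    off-X true  false = _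
    off-X false true  = fromWitness refl
    off-X false false = _

  parity-oddComp : ∀ r → [ oddComp r ] ≡ ∑[ v < n ] ([ sameComp G R r v ] * (π v + N v))
  parity-oddComp r = begin
    [ oddComp r ]
      ≡⟨ cong (λ z → [ isOdd (z ℤ.+ ℤ.+ eComp G R r B) ]) (Σℤ-over C f fℕ f≡+fℕ) ⟩
    [ isOdd (ℤ.+ weight ℤ.+ ℤ.+ eComp G R r B) ]
      ≡⟨ cong (λ z → [ isOdd z ]) (ℤ.pos-+ weight (eComp G R r B)) ⟨
    [ isOdd (ℤ.+ (weight ℕ.+ eComp G R r B)) ]
      ≡⟨ [isOdd]-pos (weight ℕ.+ eComp G R r B) ⟩
    parity (weight ℕ.+ eComp G R r B)
      ≡⟨ +-homo-+ weight (eComp G R r B) ⟩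
    parity weight + parity (eComp G R r B)
      ≡⟨ cong₂ _+_ (parity-Σℕ-over C fℕ parity-fℕ)
                   (parity-Σℕ-over C (λ v → count (λ w → adj G v w ∧ B w))
                                     (λ v → parity-count (λ w → adj G v w ∧ B w))) ⟩
    ∑[ v < n ] ([ C v ] * π v) + ∑[ v < n ] ([ C v ] * N v)
      ≡⟨ ∑-distrib-+ (λ v → [ C v ] * π v) (λ v → [ C v ] * N v) ⟨
    ∑[ v < n ] (([ C v ] * π v) + ([ C v ] * N v))
      ≡⟨ sum-cong-≗ (λ v → *-distribˡ-+ [ C v ] (π v) (N v)) ⟨
    ∑[ v < n ] ([ C v ] * (π v + N v)) ∎
    where
    C : VSet n
    C = sameComp G R r
    weight : ℕ
    weight = Σℕ (λ v → if C v then fℕ v else 0)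

  parity-d : parity d ≡ ∑[ v < n ] ([ R v ] * (π v + N v))
  parity-d = begin
    parity d
      ≡⟨ parity-count (λ r → isRep r ∧ agreesOffW r ∧ oddComp r) ⟩
    ∑[ r < n ] [ isRep r ∧ agreesOffW r ∧ oddComp r ]
      ≡⟨ sum-cong-≗ counted ⟩
    ∑[ r < n ] ([ isRep r ] * ∑[ v < n ] ([ sameComp G R r v ] * (π v + N v)))
      ≡⟨ ∑-over-components (λ v → π v + N v) ⟩
    ∑[ v < n ] ([ R v ] * (π v + N v)) ∎
    where
    counted : ∀ r → [ isRep r ∧ agreesOffW r ∧ oddComp r ] ≡
                    [ isRep r ] * ∑[ v < n ] ([ sameComp G R r v ] * (π v + N v))
    counted r = begin
      [ isRep r ∧ agreesOffW r ∧ oddComp r ]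
        ≡⟨ [∧] (isRep r) (agreesOffW r ∧ oddComp r) ⟩
      [ isRep r ] * [ agreesOffW r ∧ oddComp r ]
        ≡⟨ cong ([ isRep r ] *_) ([∧] (agreesOffW r) (oddComp r)) ⟩
      [ isRep r ] * ([ agreesOffW r ] * [ oddComp r ])
        ≡⟨ cong (λ p → [ isRep r ] * (p * [ oddComp r ])) ([]-T (agreesOffW-holds r)) ⟩
      [ isRep r ] * [ oddComp r ]
        ≡⟨ cong ([ isRep r ] *_) (parity-oddComp r) ⟩
      [ isRep r ] * ∑[ v < n ] ([ sameComp G R r v ] * (π v + N v)) ∎

  parity-a+b+c+d : parity (a ℕ.+ b ℕ.+ c ℕ.+ d) ≡ ∑[ v < n ] π v
  parity-a+b+c+d = begin
    parity (a ℕ.+ b ℕ.+ c ℕ.+ d)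
      ≡⟨ trans (+-homo-+ (a ℕ.+ b ℕ.+ c) d)
           (cong (_+ parity d) (trans (+-homo-+ (a ℕ.+ b) c) (cong (_+ parity c) (+-homo-+ a b)))) ⟩
    parity a + parity b + parity c + parity d
      ≡⟨ cong₂ _+_ (cong₂ _+_ (cong₂ _+_ parity-a parity-b) parity-c) (trans parity-d split-R) ⟩
    (Aπ + Bπ + RN) + (RN + Rπ)
      ≡⟨ x+y+[y+z]≡x+z (Aπ + Bπ) RN Rπ ⟩
    Aπ + Bπ + Rπ
      ≡⟨ cong (_+ Rπ) (∑-distrib-+ (λ v → [ A v ] * π v) (λ v → [ B v ] * π v)) ⟨
    ∑[ v < n ] (([ A v ] * π v) + ([ B v ] * π v)) + Rπ
      ≡⟨ ∑-distrib-+ (λ v → ([ A v ] * π v) + ([ B v ] * π v)) (λ v → [ R v ] * π v) ⟨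
    ∑[ v < n ] (([ A v ] * π v) + ([ B v ] * π v) + ([ R v ] * π v))
      ≡⟨ sum-cong-≗ every-vertex-once ⟩
    ∑[ v < n ] π v ∎
    where
    Aπ Bπ Rπ RN : Parity
    Aπ = ∑[ v < n ] ([ A v ] * π v)
    Bπ = ∑[ v < n ] ([ B v ] * π v)
    Rπ = ∑[ v < n ] ([ R v ] * π v)
    RN = ∑[ v < n ] ([ R v ] * N v)
    split-R : ∑[ v < n ] ([ R v ] * (π v + N v)) ≡ RN + Rπ
    split-R = trans (sum-cong-≗ (λ v → *-distribˡ-+ [ R v ] (π v) (N v)))
                    (trans (∑-distrib-+ (λ v → [ R v ] * π v) (λ v → [ R v ] * N v)) (+-comm Rπ RN))
    every-vertex-once : ∀ v → ([ A v ] * π v) + ([ B v ] * π v) + ([ R v ] * π v) ≡ π v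
    every-vertex-once v = begin
      ([ A v ] * π v) + ([ B v ] * π v) + ([ R v ] * π v)
        ≡⟨ cong (_+ ([ R v ] * π v)) (*-distribʳ-+ (π v) [ A v ] [ B v ]) ⟨
      ([ A v ] + [ B v ]) * π v + ([ R v ] * π v)
        ≡⟨ *-distribʳ-+ (π v) ([ A v ] + [ B v ]) [ R v ] ⟨
      ([ A v ] + [ B v ] + [ R v ]) * π v
        ≡⟨ cong (_* π v) ([]-partition (A v) (B v) (A∩B=∅ v)) ⟩
      π v ∎

  ∑π≡parity-kY : ∑[ v < n ] π v ≡ parity (k ℕ.* count (λ v → not (X v)))
  ∑π≡parity-kY = begin
    ∑[ v < n ] (parity k * [ not (X v) ])       ≡⟨ *-distribˡ-sum (parity k) (λ v → [ not (X v) ]) ⟨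
    parity k * ∑[ v < n ] [ not (X v) ]         ≡⟨ cong (parity k *_) (parity-count (λ v → not (X v))) ⟨
    parity k * parity (count (λ v → not (X v))) ≡⟨ *-homo-* k (count (λ v → not (X v))) ⟨
    parity (k ℕ.* count (λ v → not (X v)))      ∎

open import Defs
open import Data.Bool using (Bool; true; false; not; if_then_else_)
open import Data.Nat using (ℕ; _≥_; _*_)
open import Data.Nat.Divisibility using () renaming (_∣_ to _∣ℕ_)
open import Data.Integer using (ℤ; +_)
open import Data.Integer.Divisibility using (_∣_)
open import Data.Fin using (Fin)
import Relation.Binary.PropositionalEquality as ≡
open Mod2 using (2∣alternating-sum; 2∣⇒parity≡0ℙ)

lemma2p3 : ∀ {n : ℕ} (G : Graph n) (X : VSet n) → IsBipartition G X →
    (k : ℕ) → k ≥ 1 → 2 ∣ℕ (k * count (λ v → not (X v))) →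
    (A B : VSet n) → Disjoint A B →
      + 2 ∣ δ G X (λ v → if X v then + 2 else + k) (λ v → if X v then + 0 else + k) A B
lemma2p3 G X _ k _ 2∣k∣Y∣ A B A∩B=∅ =
  ≡.subst (+ 2 ∣_) (≡.sym δ≡alternating)
    (2∣alternating-sum a b c d (≡.trans parity-a+b+c+d (≡.trans ∑π≡parity-kY (2∣⇒parity≡0ℙ 2∣k∣Y∣))))
  where open Deficiency G X k A B A∩B=∅
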